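{- Fix integers $k\ge1$ and $\ell\ge\max\{4,k^2\}$, consider the tree $T_{k,\ell}$ with prediction $s=r_k$ and targets promised to lie in $B_{k,\ell}$ (defined in the context), and let $\mu$ be the uniform distribution over $B_{k,\ell}$. For every deterministic search algorithm $A$ that is correct on every target in $B_{k,\ell}$, $\mathbb{E}_{t\sim\mu}[Q_A(t)]=\Omega(k\log\ell)$, where $Q_A(t)$ is the number of oracle queries made by $A$ when the target is $t$ (the implied constant is absolute).
   Context: Recursive construction: $T_{0,\ell}$ is a single vertex $r_0$. For $h\ge1$, $T_{h,\ell}$ consists of a path $P_h=(p^h_1,\dots,p^h_\ell)$ together with, for each $i\in\{1,\dots,\ell\}$, a disjoint copy of $T_{h-1,\ell}$ whose root is joined by an edge to $p^h_i$; the root of $T_{h,\ell}$ is $r_h:=p^h_1$. Let $I=\{\lceil\ell/2\rceil,\dots,\ell\}$. For $\alpha=(i_k,\dots,i_1)\in I^k$, $v_\alpha$ is the vertex obtained by entering the copy of $T_{k-1,\ell}$ attached to $p^k_{i_k}$, then within it the copy of $T_{k-2,\ell}$ attached to its $p^{k-1}_{i_{k-1}}$, and so on down to a copy of $T_{0,\ell}$; $B_{k,\ell}:=\{v_\alpha:\alpha\in I^k\}$. Oracle: querying a vertex $x$ returns "here" if $x=t$, and otherwise the unique neighbor of $x$ on the path from $x$ to $t$. A search algorithm adaptively queries vertices and must output $t$. -}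

module Defs where

open import Data.Nat using (ℕ; zero; suc; _+_; _*_; _≤_; _≤?_; ⌈_/2⌉)
open import Data.Fin using (Fin; zero; suc; toℕ; inject₁; _≟_)
open import Data.Vec using (Vec; []; _∷_)
open import Data.List using (List; []; _∷_; [_]; map; concatMap; filter; allFin)
open import Data.Nat.ListAction using (sum)
open import Data.Maybe using (Maybe; just; nothing; maybe′)
import Data.Maybe as M
open import Relation.Nullary using (yes; no)

-- Vertices of the tree T_{h,ℓ} (paths are indexed 0..ℓ-1, i.e. p_{i+1} ↦ path i).
--   root0      : the single vertex r_0 of T_{0,ℓ}
--   path i     : the path vertex p^h_{i+1} of T_{h,ℓ} (h ≥ 1)
--   sub i x    : vertex x of the copy of T_{h-1,ℓ} attached to p^h_{i+1}
data V (ℓ : ℕ) : ℕ → Set where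
  root0 : V ℓ zero
  path  : ∀ {h} → Fin ℓ → V ℓ (suc h)
  sub   : ∀ {h} → Fin ℓ → V ℓ h → V ℓ (suc h)

zeroOf : ∀ {n} → Fin n → Fin n
zeroOf zero    = zero
zeroOf (suc _) = zero

-- root r_h of T_{h,ℓ} (r_0, resp. p^h_1); needs a witness that ℓ ≥ 1
root : ∀ {ℓ} h → Fin ℓ → V ℓ h
root zero    _ = root0
root (suc h) i = path (zeroOf i)

-- one step along the path P from index i towards index j (i itself if i = j)
towards : ∀ {n} → Fin n → Fin n → Fin n
towards zero    zero          = zero
towards zero    (suc zero)    = suc zero
towards zero    (suc (suc _)) = suc zero
towards (suc i) zero          = inject₁ i
towards (suc i) (suc j)       = suc (towards i j)

toRoot : ∀ {ℓ h} → V ℓ h → Maybe (V ℓ h)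
toRoot root0          = nothing
toRoot (path zero)    = nothing
toRoot (path (suc i)) = just (path (inject₁ i))
toRoot (sub i x)      = just (maybe′ (sub i) (path i) (toRoot x))

-- The oracle: querying x with target t returns nothing ("here") if x = t,
-- otherwise just y where y is the neighbour of x on the x–t path.
oracle : ∀ {ℓ h} → V ℓ h → V ℓ h → Maybe (V ℓ h)
oracle root0 root0 = nothing
oracle (path i) (path j) with i ≟ j
... | yes _ = nothing
... | no  _ = just (path (towards i j))
oracle {h = suc h} (path i) (sub j t) with i ≟ j
... | yes _ = just (sub j (root h j))
... | no  _ = just (path (towards i j))
oracle (sub i x) (sub j t) with i ≟ j
... | yes _ = M.map (sub i) (oracle x t)
... | no  _ = just (maybe′ (sub i) (path i) (toRoot x))
oracle (sub i x) (path j) = just (maybe′ (sub i) (path i) (toRoot x))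

-- Deterministic adaptive search algorithms on T_{h,ℓ} (decision trees):
-- either output a vertex, or query a vertex and continue depending on the answer.
data Alg (ℓ h : ℕ) : Set where
  output : V ℓ h → Alg ℓ h
  query  : V ℓ h → (Maybe (V ℓ h) → Alg ℓ h) → Alg ℓ h

result : ∀ {ℓ h} → Alg ℓ h → V ℓ h → V ℓ h
result (output v)  t = v
result (query x f) t = result (f (oracle x t)) t

Q : ∀ {ℓ h} → Alg ℓ h → V ℓ h → ℕ
Q (output v)  t = 0
Q (query x f) t = suc (Q (f (oracle x t)) t)

-- v_α for α = (i_k, …, i_1)
vα : ∀ {ℓ k} → Vec (Fin ℓ) k → V ℓ k
vα []      = root0
vα (i ∷ α) = sub i (vα α)

-- membership in I = {⌈ℓ/2⌉, …, ℓ} (1-indexed; Fin index i stands for i+1)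
InI : ∀ {ℓ} → Fin ℓ → Set
InI {ℓ} i = ⌈ ℓ /2⌉ ≤ suc (toℕ i)

data AllInI {ℓ : ℕ} : ∀ {k} → Vec (Fin ℓ) k → Set where
  []  : AllInI []
  _∷_ : ∀ {k i} {α : Vec (Fin ℓ) k} → InI i → AllInI α → AllInI (i ∷ α)

Ilist : ∀ ℓ → List (Fin ℓ)
Ilist ℓ = filter (λ i → ⌈ ℓ /2⌉ ≤? suc (toℕ i)) (allFin ℓ)

Ivecs : ∀ ℓ k → List (Vec (Fin ℓ) k)
Ivecs ℓ zero    = [ [] ]
Ivecs ℓ (suc k) = concatMap (λ i → map (i ∷_) (Ivecs ℓ k)) (Ilist ℓ)

totalQ : ∀ {ℓ k} → Alg ℓ k → ℕ
totalQ {ℓ} {k} A = sum (map (λ α → Q A (vα α)) (Ivecs ℓ k))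

-- Each oracle answer at a vertex x is one of four kinds: x is the target, or the neighbour of x
-- towards the root, along the path away from the root, or into the subtree hanging from x.
-- A correct algorithm is therefore a 4-ary decision tree, and induction on it shows that for
-- every d the query counts of N distinct targets sum to at least (d + 1) N - 4^d.
-- The targets B_{k,ℓ} number N = |I|^k ≥ 2^M with M = k (⌊log₂ ℓ⌋ - 1); the choice d = ⌊M/2⌋
-- makes 4^d ≤ N, so the total is at least N M / 4, which is of order N k log ℓ.

module Submission where

open import Defs
open import Data.Nat using (ℕ; zero; suc; _+_; _*_; _^_; _∸_; _≤_; _<_; z≤n; s≤s; ⌊_/2⌋; ⌈_/2⌉; _≤?_)
open import Data.Nat.Properties
  using ( +-*-semiring; +-assoc; +-comm; +-identityʳ; *-comm; *-identityˡ; *-identityʳ; *-assoc; *-suc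
        ; ≤-refl; ≤-reflexive; ≤-trans; ≤-pred; n≤1+n; m≤m+n; m≤n+m; m≤n⇒m≤1+n
        ; +-mono-≤; +-monoˡ-≤; +-monoʳ-≤; *-mono-≤; *-monoˡ-≤; *-monoʳ-≤; +-cancelˡ-≤; +-cancelʳ-≤
        ; ^-*-assoc; ^-monoˡ-≤; ^-monoʳ-≤; m^n>0; ∸-monoˡ-≤
        ; ⌊n/2⌋-mono; ⌊n/2⌋≤⌈n/2⌉; ⌊n/2⌋+⌈n/2⌉≡n; module ≤-Reasoning )
open import Data.Nat.DivMod using (_/_; _%_; m≡m%n+[m/n]*n; m%n<n; m/n*n≤m)
open import Data.Nat.Induction using (<-wellFounded)
open import Data.Nat.Logarithm using (⌊log₂_⌋; ⌊log₂⌋-mono-≤; ⌊log₂⌊n/2⌋⌋≡⌊log₂n⌋∸1)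
open import Data.Nat.Logarithm.Core using (⌊log2⌋)
open import Data.Nat.ListAction using (sum)
open import Data.Nat.Tactic.RingSolver using (solve-∀)
open import Data.Fin using (Fin; zero; suc; toℕ; inject₁; punchIn; _≟_)
import Data.Fin as Fin
open import Data.Fin.Properties using (<-cmp; punchInᵢ≢i)
open import Data.Vec using (Vec; []; _∷_)
open import Data.Vec.Properties using (∷-injective)
open import Data.List using (List; []; _∷_; map; filter; length; tabulate; allFin; concatMap; cartesianProductWith; _++_)
open import Data.List.Properties using (filter-accept; filter-reject; map-cong; map-∘; length-map; length-++)
open import Data.List.Membership.Propositional using (_∈_)
open import Data.List.Membership.Propositional.Properties using (∈-filter⁻; ∈-map⁻; ∈-cartesianProductWith⁻)
open import Data.List.Relation.Unary.Any using (here; there)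
open import Data.List.Relation.Unary.All using ([]; _∷_)
open import Data.List.Relation.Unary.AllPairs using ([]; _∷_)
open import Data.List.Relation.Unary.Unique.Propositional using (Unique)
import Data.List.Relation.Unary.Unique.Propositional.Properties as Unique
open import Data.Maybe using (Maybe; just; nothing)
import Data.Maybe as Maybe
open import Data.Product using (Σ; _×_; _,_; proj₂)
open import Function using (_∘_)
open import Induction.WellFounded using (Acc; acc)
open import Relation.Binary.Definitions using (tri<; tri≈; tri>)
open import Relation.Binary.PropositionalEquality
  using (_≡_; _≢_; refl; sym; trans; cong; cong₂; subst₂; module ≡-Reasoning)
open import Relation.Nullary using (yes; no; contradiction)
open import Relation.Unary using (Pred; Decidable)
open import Algebra.Properties.Semiring.Sum +-*-semiring
  using (sum-syntax; sum-remove; sum-cong-≗; sum-replicate-zero; ∑-distrib-+; *-distribˡ-sum)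

∑-mono-≤ : ∀ {n} {f g : Fin n → ℕ} → (∀ i → f i ≤ g i) → ∑[ i < n ] f i ≤ ∑[ i < n ] g i
∑-mono-≤ {zero}  f≤g = z≤n
∑-mono-≤ {suc n} f≤g = +-mono-≤ (f≤g zero) (∑-mono-≤ (f≤g ∘ suc))

∑-const : ∀ n a → ∑[ i < n ] a ≡ n * a
∑-const zero    a = refl
∑-const (suc n) a = cong (a +_) (∑-const n a)

∑-add-at : ∀ {n} (j : Fin n) a {F G : Fin n → ℕ} →
           G j ≡ a + F j → (∀ i → i ≢ j → G i ≡ F i) → ∑[ i < n ] G i ≡ a + ∑[ i < n ] F i
∑-add-at {suc n} j a {F} {G} Gj≡a+Fj G≡F = begin
  ∑[ i < suc n ] G i                      ≡⟨ sum-remove {i = j} G ⟩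
  G j + ∑[ i < n ] G (punchIn j i)        ≡⟨ cong₂ _+_ Gj≡a+Fj (sum-cong-≗ (λ i → G≡F (punchIn j i) (punchInᵢ≢i j i))) ⟩
  a + F j + ∑[ i < n ] F (punchIn j i)    ≡⟨ +-assoc a (F j) _ ⟩
  a + (F j + ∑[ i < n ] F (punchIn j i))  ≡⟨ cong (a +_) (sym (sum-remove {i = j} F)) ⟩
  a + ∑[ i < suc n ] F i                  ∎
  where open ≡-Reasoning

sum-map-suc : ∀ {X : Set} (h : X → ℕ) (L : List X) → sum (map (suc ∘ h) L) ≡ length L + sum (map h L)
sum-map-suc h []      = refl
sum-map-suc h (x ∷ L) = cong suc (trans (cong (h x +_) (sum-map-suc h L)) (swap (h x) (length L) _))
  where
  swap : ∀ a n s → a + (n + s) ≡ n + (a + s)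
  swap = solve-∀

sum-map-1≡length : ∀ {X : Set} (L : List X) → sum (map (λ _ → 1) L) ≡ length L
sum-map-1≡length []      = refl
sum-map-1≡length (_ ∷ L) = cong suc (sum-map-1≡length L)

module _ {X : Set} {b : ℕ} (c : X → Fin b) where

  fibre : Fin b → List X → List X
  fibre i = filter (λ t → c t ≟ i)

  sum-map≡∑-fibres : (g : X → Fin b → ℕ) (L : List X) →
                     sum (map (λ t → g t (c t)) L) ≡ ∑[ i < b ] sum (map (λ t → g t i) (fibre i L))
  sum-map≡∑-fibres g []      = sym (sum-replicate-zero b)
  sum-map≡∑-fibres g (x ∷ L) = begin
    g x (c x) + sum (map (λ t → g t (c t)) L)  ≡⟨ cong (g x (c x) +_) (sum-map≡∑-fibres g L) ⟩
    g x (c x) + ∑[ i < b ] F L i               ≡⟨ sym (∑-add-at (c x) (g x (c x)) accept reject) ⟩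
    ∑[ i < b ] F (x ∷ L) i                     ∎
    where
    open ≡-Reasoning
    F : List X → Fin b → ℕ
    F L′ i = sum (map (λ t → g t i) (fibre i L′))
    accept : F (x ∷ L) (c x) ≡ g x (c x) + F L (c x)
    accept = cong (sum ∘ map (λ t → g t (c x))) (filter-accept (λ t → c t ≟ c x) refl)
    reject : ∀ i → i ≢ c x → F (x ∷ L) i ≡ F L i
    reject i i≢cx = cong (sum ∘ map (λ t → g t i)) (filter-reject (λ t → c t ≟ i) (i≢cx ∘ sym))

  length≡∑-fibres : (L : List X) → length L ≡ ∑[ i < b ] length (fibre i L)
  length≡∑-fibres L = begin
    length L                                   ≡⟨ sym (sum-map-1≡length L) ⟩
    sum (map (λ _ → 1) L)                      ≡⟨ sum-map≡∑-fibres (λ _ _ → 1) L ⟩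
    ∑[ i < b ] sum (map (λ _ → 1) (fibre i L)) ≡⟨ sum-cong-≗ (λ i → sum-map-1≡length (fibre i L)) ⟩
    ∑[ i < b ] length (fibre i L)              ∎
    where open ≡-Reasoning

Unique∧constant⇒length≤1 : ∀ {X : Set} {v : X} {L : List X} → Unique L → (∀ {t} → t ∈ L → v ≡ t) → length L ≤ 1
Unique∧constant⇒length≤1 {L = []}          _                 _     = z≤n
Unique∧constant⇒length≤1 {L = _ ∷ []}      _                 _     = s≤s z≤n
Unique∧constant⇒length≤1 {L = _ ∷ _ ∷ _}   ((x≢y ∷ _) ∷ _)  v≡all =
  contradiction (trans (sym (v≡all (here refl))) (v≡all (there (here refl)))) x≢y

n<2^n : ∀ n → n < 2 ^ n
n<2^n zero    = s≤s z≤n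
n<2^n (suc n) = +-mono-≤ (m^n>0 2 n) (≤-trans (n<2^n n) (m≤m+n (2 ^ n) 0))

2*⌊n/2⌋≤n : ∀ n → 2 * ⌊ n /2⌋ ≤ n
2*⌊n/2⌋≤n n = begin
  2 * ⌊ n /2⌋        ≡⟨ cong (⌊ n /2⌋ +_) (+-identityʳ _) ⟩
  ⌊ n /2⌋ + ⌊ n /2⌋  ≤⟨ +-monoʳ-≤ ⌊ n /2⌋ (⌊n/2⌋≤⌈n/2⌉ n) ⟩
  ⌊ n /2⌋ + ⌈ n /2⌉  ≡⟨ ⌊n/2⌋+⌈n/2⌉≡n n ⟩
  n                  ∎
  where open ≤-Reasoning

2^⌊log2⌋≤n : ∀ n (rec : Acc _<_ n) → 1 ≤ n → 2 ^ ⌊log2⌋ n rec ≤ n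
2^⌊log2⌋≤n (suc zero)    _        _ = ≤-refl
2^⌊log2⌋≤n (suc (suc n)) (acc rs) _ = begin
  2 * 2 ^ ⌊log2⌋ (suc ⌊ n /2⌋) _  ≤⟨ *-monoʳ-≤ 2 (2^⌊log2⌋≤n (suc ⌊ n /2⌋) _ (s≤s z≤n)) ⟩
  2 * suc ⌊ n /2⌋                 ≡⟨ *-suc 2 ⌊ n /2⌋ ⟩
  2 + 2 * ⌊ n /2⌋                 ≤⟨ +-monoʳ-≤ 2 (2*⌊n/2⌋≤n n) ⟩
  2 + n                           ∎
  where open ≤-Reasoning

2^⌊log₂n⌋≤n : ∀ n → 1 ≤ n → 2 ^ ⌊log₂ n ⌋ ≤ n
2^⌊log₂n⌋≤n n = 2^⌊log2⌋≤n n (<-wellFounded n)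

bᵈ≤N⇒d*N≤S : ∀ {b d N S} → b ^ d ≤ N → suc d * N ≤ S + b ^ d → d * N ≤ S
bᵈ≤N⇒d*N≤S {b} {d} {N} {S} bᵈ≤N depth-d = +-cancelˡ-≤ N (d * N) S (begin
  N + d * N  ≤⟨ depth-d ⟩
  S + b ^ d  ≤⟨ +-monoʳ-≤ S bᵈ≤N ⟩
  S + N      ≡⟨ +-comm S N ⟩
  N + S      ∎)
  where open ≤-Reasoning

depth-bounds⇒N*M≤4*S : ∀ {M N S} → 1 ≤ M → 2 ^ M ≤ N → (∀ d → suc d * N ≤ S + 4 ^ d) → N * M ≤ 4 * S
depth-bounds⇒N*M≤4*S {M} {N} {S} 1≤M 2^M≤N depth = begin
  N * M                     ≡⟨ cong (N *_) (m≡m%n+[m/n]*n M 2) ⟩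
  N * (M % 2 + q * 2)       ≡⟨ rearrange N (M % 2) q ⟩
  N * (M % 2) + q * N * 2   ≤⟨ +-mono-≤ (*-monoʳ-≤ N (≤-pred (m%n<n M 2))) (*-monoˡ-≤ 2 (bᵈ≤N⇒d*N≤S {4} {q} 4^q≤N (depth q))) ⟩
  N * 1 + S * 2             ≤⟨ +-monoˡ-≤ (S * 2) (≤-trans (≤-reflexive (*-identityʳ N)) N≤2S) ⟩
  2 * S + S * 2             ≡⟨ collect S ⟩
  4 * S                     ∎
  where
  open ≤-Reasoning
  rearrange : ∀ n r q → n * (r + q * 2) ≡ n * r + q * n * 2
  rearrange = solve-∀
  collect : ∀ s → 2 * s + s * 2 ≡ 4 * s
  collect = solve-∀
  q : ℕ
  q = M / 2
  4^q≤N : 4 ^ q ≤ N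
  4^q≤N = begin
    4 ^ q        ≡⟨ ^-*-assoc 2 2 q ⟩
    2 ^ (2 * q)  ≤⟨ ^-monoʳ-≤ 2 (≤-trans (≤-reflexive (*-comm 2 q)) (m/n*n≤m M 2)) ⟩
    2 ^ M        ≤⟨ 2^M≤N ⟩
    N            ∎
  N≤S+1 : N ≤ S + 1
  N≤S+1 = ≤-trans (≤-reflexive (sym (*-identityˡ N))) (depth 0)
  1≤S : 1 ≤ S
  1≤S = +-cancelʳ-≤ 1 1 S (≤-trans (≤-trans (^-monoʳ-≤ 2 1≤M) 2^M≤N) N≤S+1)
  N≤2S : N ≤ 2 * S
  N≤2S = begin
    N      ≤⟨ N≤S+1 ⟩
    S + 1  ≤⟨ +-monoʳ-≤ S 1≤S ⟩
    S + S  ≡⟨ cong (S +_) (sym (+-identityʳ S)) ⟩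
    2 * S  ∎

k*L≤2*[L∸1]*k : ∀ k L → 2 ≤ L → k * L ≤ 2 * ((L ∸ 1) * k)
k*L≤2*[L∸1]*k k (suc zero)    (s≤s ())
k*L≤2*[L∸1]*k k (suc (suc m)) _ = begin
  k * (2 + m)          ≤⟨ m≤m+n _ (k * m) ⟩
  k * (2 + m) + k * m  ≡⟨ rearrange k m ⟩
  2 * ((1 + m) * k)    ∎
  where
  open ≤-Reasoning
  rearrange : ∀ k m → k * (2 + m) + k * m ≡ 2 * ((1 + m) * k)
  rearrange = solve-∀

record FiniteAnswers (ℓ h b : ℕ) : Set where
  field
    classify       : V ℓ h → V ℓ h → Fin b
    decode         : V ℓ h → Fin b → Maybe (V ℓ h)
    oracle-factors : ∀ x t → oracle x t ≡ decode x (classify x t)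

sumQ : ∀ {ℓ h} → Alg ℓ h → List (V ℓ h) → ℕ
sumQ A L = sum (map (Q A) L)

module _ {ℓ h b : ℕ} (answers : FiniteAnswers ℓ h b) where
  open FiniteAnswers answers

  sumQ-query : ∀ x f L → sumQ (query x f) L ≡
               length L + ∑[ i < b ] sumQ (f (decode x i)) (fibre (classify x) i L)
  sumQ-query x f L = begin
    sumQ (query x f) L                                               ≡⟨ sum-map-suc (λ t → Q (f (oracle x t)) t) L ⟩
    length L + sum (map (λ t → Q (f (oracle x t)) t) L)              ≡⟨ cong (λ ts → length L + sum ts) (map-cong answer≡decoded L) ⟩
    length L + sum (map (λ t → Q (f (decode x (classify x t))) t) L)  ≡⟨ cong (length L +_) (sum-map≡∑-fibres (classify x) (λ t i → Q (f (decode x i)) t) L) ⟩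
    length L + ∑[ i < b ] sumQ (f (decode x i)) (fibre (classify x) i L) ∎
    where
    open ≡-Reasoning
    answer≡decoded : ∀ t → Q (f (oracle x t)) t ≡ Q (f (decode x (classify x t))) t
    answer≡decoded t = cong (λ a → Q (f a) t) (oracle-factors x t)

  sumQ-depth-bound : 2 ≤ b → ∀ d (A : Alg ℓ h) L → Unique L → (∀ {t} → t ∈ L → result A t ≡ t) →
                      suc d * length L ≤ sumQ A L + b ^ d
  sumQ-depth-bound 2≤b d (output v) L unique correct = begin
    suc d * length L           ≤⟨ *-monoʳ-≤ (suc d) (Unique∧constant⇒length≤1 unique correct) ⟩
    suc d * 1                  ≡⟨ *-identityʳ (suc d) ⟩
    suc d                      ≤⟨ ≤-trans (n<2^n d) (^-monoˡ-≤ d 2≤b) ⟩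
    b ^ d                      ≤⟨ m≤n+m (b ^ d) _ ⟩
    sumQ (output v) L + b ^ d  ∎
    where open ≤-Reasoning
  sumQ-depth-bound 2≤b zero (query x f) L _ _ = begin
    1 * length L            ≡⟨ *-identityˡ (length L) ⟩
    length L                ≤⟨ m≤m+n (length L) _ ⟩
    length L + _            ≡⟨ sym (sumQ-query x f L) ⟩
    sumQ (query x f) L      ≤⟨ m≤m+n _ 1 ⟩
    sumQ (query x f) L + 1  ∎
    where open ≤-Reasoning
  sumQ-depth-bound 2≤b (suc d) (query x f) L unique correct = begin
    suc (suc d) * length L                                 ≡⟨ cong (λ n → length L + suc d * n) (length≡∑-fibres (classify x) L) ⟩
    length L + suc d * ∑[ i < b ] length (Lᵢ i)            ≡⟨ cong (length L +_) (*-distribˡ-sum (suc d) (length ∘ Lᵢ)) ⟩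
    length L + ∑[ i < b ] (suc d * length (Lᵢ i))          ≤⟨ +-monoʳ-≤ (length L) (∑-mono-≤ ih) ⟩
    length L + ∑[ i < b ] (Sᵢ i + b ^ d)                   ≡⟨ cong (length L +_) (∑-distrib-+ Sᵢ (λ _ → b ^ d)) ⟩
    length L + (∑[ i < b ] Sᵢ i + ∑[ i < b ] (b ^ d))      ≡⟨ cong (λ s → length L + (∑[ i < b ] Sᵢ i + s)) (∑-const b (b ^ d)) ⟩
    length L + (∑[ i < b ] Sᵢ i + b ^ suc d)               ≡⟨ sym (+-assoc (length L) _ _) ⟩
    length L + ∑[ i < b ] Sᵢ i + b ^ suc d                 ≡⟨ cong (_+ b ^ suc d) (sym (sumQ-query x f L)) ⟩
    sumQ (query x f) L + b ^ suc d                         ∎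
    where
    open ≤-Reasoning
    Lᵢ : Fin b → List (V ℓ h)
    Lᵢ i = fibre (classify x) i L
    Aᵢ : Fin b → Alg ℓ h
    Aᵢ i = f (decode x i)
    Sᵢ : Fin b → ℕ
    Sᵢ i = sumQ (Aᵢ i) (Lᵢ i)
    correctᵢ : ∀ i {t} → t ∈ Lᵢ i → result (Aᵢ i) t ≡ t
    correctᵢ i {t} t∈Lᵢ with ∈-filter⁻ (λ t → classify x t ≟ i) {xs = L} t∈Lᵢ
    ... | t∈L , refl = trans (cong (λ a → result (f a) t) (sym (oracle-factors x t))) (correct t∈L)
    ih : ∀ i → suc d * length (Lᵢ i) ≤ Sᵢ i + b ^ d
    ih i = sumQ-depth-bound 2≤b d (Aᵢ i) (Lᵢ i) (Unique.filter⁺ (λ t → classify x t ≟ i) unique) (correctᵢ i)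

Direction : Set
Direction = Fin 4

pattern found     = zero
pattern upward    = suc zero
pattern rightward = suc (suc zero)
pattern downward  = suc (suc (suc zero))

stepRight : ∀ {n} → Fin n → Fin n
stepRight {suc zero}    zero    = zero
stepRight {suc (suc _)} zero    = suc zero
stepRight               (suc i) = suc (stepRight i)

towards-left : ∀ {n} {i : Fin n} {j : Fin (suc n)} → j Fin.< suc i → towards (suc i) j ≡ inject₁ i
towards-left {j = zero}              _         = refl
towards-left {i = zero}  {suc _}     (s≤s ())
towards-left {i = suc _} {suc _}     (s≤s j<i) = cong suc (towards-left j<i)

towards-right : ∀ {n} {i j : Fin n} → i Fin.< j → towards i j ≡ stepRight i
towards-right {i = zero}  {suc zero}    _         = refl
towards-right {i = zero}  {suc (suc _)} _         = refl
towards-right {i = suc _} {suc _}       (s≤s i<j) = cong suc (towards-right i<j)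

pathDirection : ∀ {n} → Fin n → Fin n → Direction
pathDirection i j with <-cmp i j
... | tri< _ _ _ = rightward
... | tri≈ _ _ _ = found
... | tri> _ _ _ = upward

direction : ∀ {ℓ h} → V ℓ h → V ℓ h → Direction
direction root0     root0     = found
direction (path i)  (path j)  with i ≟ j
... | yes _ = found
... | no  _ = pathDirection i j
direction (path i)  (sub j _) with i ≟ j
... | yes _ = downward
... | no  _ = pathDirection i j
direction (sub _ _) (path _)  = upward
direction (sub i x) (sub j t) with i ≟ j
... | yes _ = direction x t
... | no  _ = upward

neighbour : ∀ {ℓ h} → V ℓ h → Direction → Maybe (V ℓ h)
neighbour _                   found     = nothing
neighbour x                   upward    = toRoot x
neighbour root0               _         = nothing
neighbour (path i)            rightward = just (path (stepRight i))
neighbour {h = suc h} (path i) downward = just (sub i (root h i))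
neighbour (sub i x)           d         = Maybe.map (sub i) (neighbour x d)

oracle-along-path : ∀ {ℓ h} {i j : Fin ℓ} → i ≢ j →
                    just (path {h = h} (towards i j)) ≡ neighbour (path i) (pathDirection i j)
oracle-along-path {i = i} {j} i≢j with <-cmp i j
... | tri< i<j _ _ = cong (just ∘ path) (towards-right i<j)
... | tri≈ _ i≡j _ = contradiction i≡j i≢j
oracle-along-path {i = zero}  _ | tri> _ _ ()
oracle-along-path {i = suc _} _ | tri> _ _ j<i = cong (just ∘ path) (towards-left j<i)

neighbour-sub-path : ∀ {ℓ h} (k i j : Fin ℓ) →
  neighbour (sub k (path {h = h} i)) (pathDirection i j) ≡ Maybe.map (sub k) (neighbour (path i) (pathDirection i j))
neighbour-sub-path k i j with <-cmp i j
... | tri< _ _ _ = refl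
... | tri≈ _ _ _ = refl
neighbour-sub-path k zero    j | tri> _ _ ()
neighbour-sub-path k (suc _) j | tri> _ _ _ = refl

neighbour-sub-sub : ∀ {ℓ h} (k i : Fin ℓ) (x : V ℓ h) (d : Direction) →
  neighbour (sub k (sub i x)) d ≡ Maybe.map (sub k) (neighbour (sub i x) d)
neighbour-sub-sub k i x found     = refl
neighbour-sub-sub k i x upward    = refl
neighbour-sub-sub k i x rightward = refl
neighbour-sub-sub k i x downward  = refl

-- Inside a copy of T_{h-1}, an upward answer never occurs at the copy's root, where it would leave the copy.
neighbour-sub : ∀ {ℓ h} (k : Fin ℓ) (x t : V ℓ h) →
  neighbour (sub k x) (direction x t) ≡ Maybe.map (sub k) (neighbour x (direction x t))
neighbour-sub k root0      root0     = refl
neighbour-sub k (path i)   (path j)  with i ≟ j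
... | yes _ = refl
... | no  _ = neighbour-sub-path k i j
neighbour-sub k (path i)   (sub j _) with i ≟ j
... | yes _ = refl
... | no  _ = neighbour-sub-path k i j
neighbour-sub k (sub i x)  t         = neighbour-sub-sub k i x (direction (sub i x) t)

oracle≡neighbour∘direction : ∀ {ℓ h} (x t : V ℓ h) → oracle x t ≡ neighbour x (direction x t)
oracle≡neighbour∘direction root0     root0     = refl
oracle≡neighbour∘direction (path i)  (path j)  with i ≟ j
... | yes _   = refl
... | no  i≢j = oracle-along-path i≢j
oracle≡neighbour∘direction (path i)  (sub j _) with i ≟ j
... | yes refl = refl
... | no  i≢j  = oracle-along-path i≢j
oracle≡neighbour∘direction (sub _ _) (path _)  = refl
oracle≡neighbour∘direction (sub i x) (sub j t) with i ≟ j
... | yes refl = trans (cong (Maybe.map (sub i)) (oracle≡neighbour∘direction x t)) (sym (neighbour-sub i x t))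
... | no  _    = refl

treeAnswers : ∀ {ℓ h} → FiniteAnswers ℓ h 4
treeAnswers = record
  { classify       = direction
  ; decode         = neighbour
  ; oracle-factors = oracle≡neighbour∘direction
  }

concatMap-map≡cartesianProductWith : ∀ {A B C : Set} (f : A → B → C) (xs : List A) (ys : List B) →
                                     concatMap (λ x → map (f x) ys) xs ≡ cartesianProductWith f xs ys
concatMap-map≡cartesianProductWith f []       ys = refl
concatMap-map≡cartesianProductWith f (x ∷ xs) ys = cong (map (f x) ys ++_) (concatMap-map≡cartesianProductWith f xs ys)

length-cartesianProductWith : ∀ {A B C : Set} (f : A → B → C) (xs : List A) (ys : List B) →
                              length (cartesianProductWith f xs ys) ≡ length xs * length ys
length-cartesianProductWith f []       ys = refl
length-cartesianProductWith f (x ∷ xs) ys = begin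
  length (map (f x) ys ++ cartesianProductWith f xs ys)          ≡⟨ length-++ (map (f x) ys) ⟩
  length (map (f x) ys) + length (cartesianProductWith f xs ys)  ≡⟨ cong₂ _+_ (length-map (f x) ys) (length-cartesianProductWith f xs ys) ⟩
  length ys + length xs * length ys                              ∎
  where open ≡-Reasoning

Ivecs-suc : ∀ ℓ k → Ivecs ℓ (suc k) ≡ cartesianProductWith _∷_ (Ilist ℓ) (Ivecs ℓ k)
Ivecs-suc ℓ k = concatMap-map≡cartesianProductWith _∷_ (Ilist ℓ) (Ivecs ℓ k)

length-Ivecs : ∀ ℓ k → length (Ivecs ℓ k) ≡ length (Ilist ℓ) ^ k
length-Ivecs ℓ zero    = refl
length-Ivecs ℓ (suc k) = begin
  length (Ivecs ℓ (suc k))                                   ≡⟨ cong length (Ivecs-suc ℓ k) ⟩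
  length (cartesianProductWith _∷_ (Ilist ℓ) (Ivecs ℓ k))    ≡⟨ length-cartesianProductWith _∷_ (Ilist ℓ) (Ivecs ℓ k) ⟩
  length (Ilist ℓ) * length (Ivecs ℓ k)                      ≡⟨ cong (length (Ilist ℓ) *_) (length-Ivecs ℓ k) ⟩
  length (Ilist ℓ) ^ suc k                                   ∎
  where open ≡-Reasoning

Ivecs-unique : ∀ ℓ k → Unique (Ivecs ℓ k)
Ivecs-unique ℓ zero    = [] ∷ []
Ivecs-unique ℓ (suc k) rewrite Ivecs-suc ℓ k =
  Unique.cartesianProductWith⁺ _∷_ ∷-injective
    (Unique.filter⁺ (λ i → ⌈ ℓ /2⌉ ≤? suc (toℕ i)) (Unique.allFin⁺ ℓ)) (Ivecs-unique ℓ k)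

∈-Ivecs⇒AllInI : ∀ {ℓ k} {α : Vec (Fin ℓ) k} → α ∈ Ivecs ℓ k → AllInI α
∈-Ivecs⇒AllInI {k = zero}      (here refl) = []
∈-Ivecs⇒AllInI {ℓ} {suc k} α∈ rewrite Ivecs-suc ℓ k
  with ∈-cartesianProductWith⁻ _∷_ (Ilist ℓ) (Ivecs ℓ k) α∈
... | i , α′ , i∈I , α′∈ , refl = proj₂ (∈-filter⁻ (λ i → ⌈ ℓ /2⌉ ≤? suc (toℕ i)) {xs = allFin ℓ} i∈I) ∷ ∈-Ivecs⇒AllInI α′∈

sub-injective : ∀ {ℓ h} {i j : Fin ℓ} {x y : V ℓ h} → sub i x ≡ sub j y → i ≡ j × x ≡ y
sub-injective refl = refl , refl

vα-injective : ∀ {ℓ k} {α β : Vec (Fin ℓ) k} → vα α ≡ vα β → α ≡ β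
vα-injective {α = []}    {[]}    _ = refl
vα-injective {α = i ∷ α} {j ∷ β} e with sub-injective e
... | refl , vα≡vβ = cong (i ∷_) (vα-injective vα≡vβ)

length-filter-∷ : ∀ {X : Set} {p} {P : Pred X p} (P? : Decidable P) x (xs : List X) →
                  length (filter P? xs) ≤ length (filter P? (x ∷ xs))
length-filter-∷ P? x xs with P? x
... | yes _ = n≤1+n _
... | no  _ = ≤-refl

length-filter-tabulate : ∀ {X : Set} {p} {P : Pred X p} (P? : Decidable P) {n} (f : Fin n → X) m →
                         (∀ i → m ≤ toℕ i → P (f i)) → n ≤ m + length (filter P? (tabulate f))
length-filter-tabulate P? {zero}  f _       _  = z≤n
length-filter-tabulate P? {suc n} f zero    Pf = begin
  suc n                                          ≤⟨ s≤s (length-filter-tabulate P? (f ∘ suc) zero (λ i _ → Pf (suc i) z≤n)) ⟩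
  suc (length (filter P? (tabulate (f ∘ suc))))  ≡⟨ cong length (sym (filter-accept P? (Pf zero z≤n))) ⟩
  length (filter P? (tabulate f))                ∎
  where open ≤-Reasoning
length-filter-tabulate P? {suc n} f (suc m) Pf = begin
  suc n                                              ≤⟨ s≤s (length-filter-tabulate P? (f ∘ suc) m (λ i → Pf (suc i) ∘ s≤s)) ⟩
  suc (m + length (filter P? (tabulate (f ∘ suc))))  ≤⟨ s≤s (+-monoʳ-≤ m (length-filter-∷ P? (f zero) _)) ⟩
  suc m + length (filter P? (tabulate f))            ∎
  where open ≤-Reasoning

⌊ℓ/2⌋≤length-Ilist : ∀ ℓ → ⌊ ℓ /2⌋ ≤ length (Ilist ℓ)
⌊ℓ/2⌋≤length-Ilist ℓ = +-cancelʳ-≤ ⌈ ℓ /2⌉ _ _ (begin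
  ⌊ ℓ /2⌋ + ⌈ ℓ /2⌉         ≡⟨ ⌊n/2⌋+⌈n/2⌉≡n ℓ ⟩
  ℓ                         ≤⟨ length-filter-tabulate (λ i → ⌈ ℓ /2⌉ ≤? suc (toℕ i)) (λ i → i) ⌈ ℓ /2⌉ (λ _ → m≤n⇒m≤1+n) ⟩
  ⌈ ℓ /2⌉ + length (Ilist ℓ) ≡⟨ +-comm ⌈ ℓ /2⌉ _ ⟩
  length (Ilist ℓ) + ⌈ ℓ /2⌉ ∎)
  where open ≤-Reasoning

2^[⌊log₂ℓ⌋∸1]*k≤length-Ivecs : ∀ ℓ k → 2 ≤ ℓ → 2 ^ ((⌊log₂ ℓ ⌋ ∸ 1) * k) ≤ length (Ivecs ℓ k)
2^[⌊log₂ℓ⌋∸1]*k≤length-Ivecs ℓ k 2≤ℓ = begin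
  2 ^ ((⌊log₂ ℓ ⌋ ∸ 1) * k)   ≡⟨ sym (^-*-assoc 2 (⌊log₂ ℓ ⌋ ∸ 1) k) ⟩
  (2 ^ (⌊log₂ ℓ ⌋ ∸ 1)) ^ k   ≡⟨ cong (λ e → (2 ^ e) ^ k) (sym (⌊log₂⌊n/2⌋⌋≡⌊log₂n⌋∸1 ℓ)) ⟩
  (2 ^ ⌊log₂ ⌊ ℓ /2⌋ ⌋) ^ k   ≤⟨ ^-monoˡ-≤ k (2^⌊log₂n⌋≤n ⌊ ℓ /2⌋ (⌊n/2⌋-mono 2≤ℓ)) ⟩
  ⌊ ℓ /2⌋ ^ k                 ≤⟨ ^-monoˡ-≤ k (⌊ℓ/2⌋≤length-Ilist ℓ) ⟩
  length (Ilist ℓ) ^ k        ≡⟨ sym (length-Ivecs ℓ k) ⟩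
  length (Ivecs ℓ k)          ∎
  where open ≤-Reasoning

totalQ-depth-bound : ∀ {ℓ k} (A : Alg ℓ k) → ((α : Vec (Fin ℓ) k) → AllInI α → result A (vα α) ≡ vα α) →
                     ∀ d → suc d * length (Ivecs ℓ k) ≤ totalQ A + 4 ^ d
totalQ-depth-bound {ℓ} {k} A correct d =
  subst₂ (λ n s → suc d * n ≤ s + 4 ^ d) (length-map vα (Ivecs ℓ k)) (sym (cong sum (map-∘ (Ivecs ℓ k))))
    (sumQ-depth-bound treeAnswers (s≤s (s≤s z≤n)) d A (map vα (Ivecs ℓ k))
      (Unique.map⁺ vα-injective (Ivecs-unique ℓ k)) correct-on-B)
  where
  correct-on-B : ∀ {t} → t ∈ map vα (Ivecs ℓ k) → result A t ≡ t
  correct-on-B t∈B with ∈-map⁻ vα t∈B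
  ... | α , α∈ , refl = correct α (∈-Ivecs⇒AllInI α∈)

lemma4 : Σ ℕ λ c → 1 ≤ c ×
           ((k ℓ : ℕ) → 1 ≤ k → 4 ≤ ℓ → k * k ≤ ℓ →
            (A : Alg ℓ k) →
            ((α : Vec (Fin ℓ) k) → AllInI α → result A (vα α) ≡ vα α) →
            length (Ivecs ℓ k) * (k * ⌊log₂ ℓ ⌋) ≤ c * totalQ A)
lemma4 = 8 , s≤s z≤n , bound
  where
  bound : (k ℓ : ℕ) → 1 ≤ k → 4 ≤ ℓ → k * k ≤ ℓ → (A : Alg ℓ k) →
          ((α : Vec (Fin ℓ) k) → AllInI α → result A (vα α) ≡ vα α) →
          length (Ivecs ℓ k) * (k * ⌊log₂ ℓ ⌋) ≤ 8 * totalQ A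
  bound k ℓ 1≤k 4≤ℓ _ A correct = begin
    N * (k * L)          ≤⟨ *-monoʳ-≤ N (k*L≤2*[L∸1]*k k L 2≤L) ⟩
    N * (2 * M)          ≡⟨ *-comm-middle N 2 M ⟩
    2 * (N * M)          ≤⟨ *-monoʳ-≤ 2 (depth-bounds⇒N*M≤4*S 1≤M 2^M≤N (totalQ-depth-bound A correct)) ⟩
    2 * (4 * totalQ A)   ≡⟨ sym (*-assoc 2 4 (totalQ A)) ⟩
    8 * totalQ A         ∎
    where
    open ≤-Reasoning
    N L M : ℕ
    N = length (Ivecs ℓ k)
    L = ⌊log₂ ℓ ⌋
    M = (L ∸ 1) * k
    2≤L : 2 ≤ L
    2≤L = ⌊log₂⌋-mono-≤ 4≤ℓ
    1≤M : 1 ≤ M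
    1≤M = *-mono-≤ (∸-monoˡ-≤ 1 2≤L) 1≤k
    2^M≤N : 2 ^ M ≤ N
    2^M≤N = 2^[⌊log₂ℓ⌋∸1]*k≤length-Ivecs ℓ k (≤-trans (s≤s (s≤s z≤n)) 4≤ℓ)
    *-comm-middle : ∀ n a m → n * (a * m) ≡ a * (n * m)
    *-comm-middle = solve-∀
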